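{- For $n,k\ge0$ let $p_{n,k}$ be the number of integers $m\in[0,a_{2n+1})$ whose Kentucky-2 legal decomposition has exactly $k$ summands. Then for all $k\ge1$ and $n\ge 1+2(k-1)$, \[ p_{n,k}=2^k\binom{n-(k-1)}{k}. \]
   Context: The Kentucky-2 sequence $(a_n)_{n\ge1}$: index $\ell$ belongs to bin $\lceil \ell/2\rceil$. A legal decomposition of $m\ge0$ using $\{a_1,\dots,a_N\}$ is $m=a_{\ell_1}+\cdots+a_{\ell_k}$, $k\ge0$, $1\le\ell_1<\cdots<\ell_k\le N$, with $\lceil \ell_{j+1}/2\rceil-\lceil \ell_j/2\rceil\ge2$ for all $j$. The sequence is defined by $a_1=1$ and, for $N\ge1$, $a_{N+1}$ is the smallest positive integer with no legal decomposition using $\{a_1,\dots,a_N\}$ (first terms $1,2,3,4,5,8,11,16,\dots$). Every nonnegative integer has a unique legal decomposition. -}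

module Defs where

open import Data.Nat.Base using (ℕ; suc; _+_; _≤_; _<_; ⌈_/2⌉)
open import Data.List.Base using (List; map; length)
open import Data.Nat.ListAction using (sum)
open import Data.List.Relation.Unary.All using (All)
open import Data.List.Relation.Unary.Linked using (Linked)
open import Data.Product using (_×_; ∃; ∃-syntax)
open import Relation.Binary.PropositionalEquality using (_≡_)
open import Relation.Nullary using (¬_)

-- Sequences are indexed from 1: a : ℕ → ℕ with a 0 unused.

bin : ℕ → ℕ
bin ℓ = ⌈ ℓ /2⌉

LegalIndices : ℕ → List ℕ → Set
LegalIndices N ℓs =
  All (λ ℓ → 1 ≤ ℓ × ℓ ≤ N) ℓs ×
  Linked (λ i j → i < j × bin i + 2 ≤ bin j) ℓs

LegalDecomp : (ℕ → ℕ) → ℕ → ℕ → List ℕ → Set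
LegalDecomp a N m ℓs = LegalIndices N ℓs × sum (map a ℓs) ≡ m

HasLegalDecomp : (ℕ → ℕ) → ℕ → ℕ → Set
HasLegalDecomp a N m = ∃[ ℓs ] LegalDecomp a N m ℓs

IsKentucky2 : (ℕ → ℕ) → Set
IsKentucky2 a =
  a 1 ≡ 1 ×
  (∀ N → 1 ≤ N →
     1 ≤ a (suc N) ×
     ¬ HasLegalDecomp a N (a (suc N)) ×
     (∀ m → 1 ≤ m → m < a (suc N) → HasLegalDecomp a N m))

-- The (unique) legal decomposition of m has exactly k summands.
DecompHasSummands : (ℕ → ℕ) → ℕ → ℕ → Set
DecompHasSummands a m k =
  ∃[ N ] ∃[ ℓs ] (LegalDecomp a N m ℓs × length ℓs ≡ k)

-- The proof makes the Kentucky-2 sequence explicit.  For every bound N we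
-- build the list  enum N  of all legal index lists with indices ≤ N: going
-- from N to N+1 keeps the old lists and appends N+1 to every legal list whose
-- indices lie at least two bins below bin(N+1) ('enumerates-extend').  We
-- define A(N+1) = |enum N| and show, by the same recursion, that the values
-- Σ A ℓ of the lists of enum N are 0, 1, …, A(N+1) − 1 in this order
-- ('consecutive-extend').  So, for any sequence agreeing with A on 1, …, N,
-- the integers with a legal decomposition using the first N terms are exactly
-- those below A(N+1) ('representable⇔'); since a Kentucky-2 term is the least
-- positive integer that is not representable, every Kentucky-2 sequence
-- equals A ('kentucky≡A').
--
-- The integers below a(2n+1) therefore correspond bijectively to the lists of
-- enum(2n), the number of summands being the length ('withSummands⇔').
-- Writing P b for the legal lists with indices ≤ 2(b−1), the recursion gives
-- #ₖ₊₁ P(b+2) = #ₖ₊₁ P(b+1) + 2 · #ₖ P b, solved by Pascal's rule as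
-- #ₖ P b = 2ᵏ · C(b − k, k) ('count-enumP'); the theorem is the case
-- b = n + 1.  (The formula holds for every n; the hypothesis n ≥ 2k − 1 of
-- the statement only marks where it is nonzero.)
module Submission where

open import Defs
open import Data.Nat.Base using (ℕ; zero; suc; _+_; _*_; _∸_; _^_; _≤_; _<_; z≤n; s≤s; z<s; _≤′_; ≤′-refl; ≤′-step; ⌊_/2⌋; ⌈_/2⌉)
open import Data.Nat.Properties
open import Data.Nat.Combinatorics using (_C_; nCk+nC[k+1]≡[n+1]C[k+1])
open import Data.Nat.ListAction using (sum)
open import Data.Nat.ListAction.Properties using (sum-++)
open import Data.Nat.Tactic.RingSolver using (solve-∀)
open import Data.List.Base using (List; []; _∷_; [_]; _++_; _∷ʳ_; map; length; filter; upTo; applyUpTo; initLast; _∷ʳ′_)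
open import Data.List.Properties using (map-++; map-cong; map-∘; map-upTo; length-map; length-++; filter-++; filter-accept; filter-reject; filter-none)
open import Data.List.Membership.Propositional using (_∈_)
open import Data.List.Membership.Propositional.Properties using (∈-++⁺ˡ; ∈-++⁺ʳ; ∈-++⁻; ∈-map⁺; ∈-map⁻; ∈-filter⁺; ∈-filter⁻; ∈-upTo⁺; ∈-upTo⁻)
open import Data.List.Relation.Unary.Any using (here)
open import Data.List.Relation.Unary.All as All using (All; []; _∷_)
import Data.List.Relation.Unary.All.Properties as All
open import Data.List.Relation.Unary.AllPairs using (AllPairs; []; _∷_)
import Data.List.Relation.Unary.AllPairs.Properties as AllPairs
open import Data.List.Relation.Unary.Linked.Properties using (AllPairs⇒Linked; Linked⇒AllPairs)
open import Data.List.Relation.Unary.Unique.Propositional using (Unique)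
open import Data.List.Relation.Unary.Unique.Propositional.Properties using (upTo⁺)
open import Data.Product using (_×_; _,_; proj₁; ∃-syntax)
open import Data.Sum using (inj₁; inj₂)
open import Data.Empty using (⊥-elim)
open import Function.Base using (_∘_)
open import Function.Bundles using (_⇔_; mk⇔; Equivalence)
open import Relation.Binary.PropositionalEquality using (_≡_; refl; sym; trans; cong; subst; subst₂; cong₂; module ≡-Reasoning)
open import Relation.Nullary using (¬_; yes; no)

open Equivalence using (to; from)

-- Doubling by structural recursion, so that bins of 2b+1 and 2b+2 compute.
double : ℕ → ℕ
double zero = zero
double (suc b) = suc (suc (double b))

2*n≡double : ∀ n → 2 * n ≡ double n
2*n≡double zero = refl
2*n≡double (suc n) = cong suc (trans (+-suc n (n + 0)) (cong suc (2*n≡double n)))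

⌊double/2⌋ : ∀ b → ⌊ double b /2⌋ ≡ b
⌊double/2⌋ zero = refl
⌊double/2⌋ (suc b) = cong suc (⌊double/2⌋ b)

⌊1+double/2⌋ : ∀ b → ⌊ suc (double b) /2⌋ ≡ b
⌊1+double/2⌋ zero = refl
⌊1+double/2⌋ (suc b) = cong suc (⌊1+double/2⌋ b)

bin-odd : ∀ b → bin (suc (double b)) ≡ suc b
bin-odd b = cong suc (⌊double/2⌋ b)

bin-even : ∀ b → bin (suc (suc (double b))) ≡ suc b
bin-even b = cong suc (⌊1+double/2⌋ b)

≤double⇒bin≤ : ∀ {y} c → y ≤ double c → bin y ≤ c
≤double⇒bin≤ {y} c le = subst (bin y ≤_) (⌊1+double/2⌋ c) (⌈n/2⌉-mono le)

bin≤⇒≤double : ∀ {y} c → bin y ≤ c → y ≤ double c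
bin≤⇒≤double {y} c le = ≮⇒≥ λ 2c<y →
  ≤⇒≯ le (subst (_≤ bin y) (bin-odd c) (⌈n/2⌉-mono 2c<y))

Separated : ℕ → ℕ → Set
Separated i j = i < j × bin i + 2 ≤ bin j

Separated-trans : ∀ {i j k} → Separated i j → Separated j k → Separated i k
Separated-trans {j = j} (i<j , gap₁) (j<k , gap₂) =
  <-trans i<j j<k , ≤-trans gap₁ (≤-trans (m≤m+n (bin j) 2) gap₂)

InRange : ℕ → ℕ → Set
InRange N y = 1 ≤ y × y ≤ N

-- Since Separated is transitive, legality may be stated for all pairs of
-- indices rather than only consecutive ones; this is the form used below.
Legal : ℕ → List ℕ → Set
Legal N ℓs = All (InRange N) ℓs × AllPairs Separated ℓs

legal⇒indices : ∀ {N ℓs} → Legal N ℓs → LegalIndices N ℓs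
legal⇒indices (inRange , pairs) = inRange , AllPairs⇒Linked pairs

indices⇒legal : ∀ {N ℓs} → LegalIndices N ℓs → Legal N ℓs
indices⇒legal (inRange , linked) = inRange , Linked⇒AllPairs Separated-trans linked

legal-weaken : ∀ {M N ℓs} → M ≤ N → Legal M ℓs → Legal N ℓs
legal-weaken M≤N (inRange , pairs) = All.map (λ (p , q) → p , ≤-trans q M≤N) inRange , pairs

allPairs-∷ʳ⁻ : ∀ {R : ℕ → ℕ → Set} xs {x} →
  AllPairs R (xs ∷ʳ x) → AllPairs R xs × All (λ y → R y x) xs
allPairs-∷ʳ⁻ [] _ = [] , []
allPairs-∷ʳ⁻ (y ∷ xs) (ry ∷ rs) =
  let pairs , toX = allPairs-∷ʳ⁻ xs rs
  in All.++⁻ˡ xs ry ∷ pairs , All.head (All.++⁻ʳ xs ry) ∷ toX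

CanPrecede : List ℕ → ℕ → Set
CanPrecede xs x = AllPairs Separated xs × All (λ y → 1 ≤ y × Separated y x) xs

-- Appending a last index x: all earlier indices lie below x, so the range
-- bound N constrains x only.
legal-∷ʳ : ∀ {N} xs x → Legal N (xs ∷ʳ x) ⇔ (InRange N x × CanPrecede xs x)
legal-∷ʳ {N} xs x = mk⇔ split join
  where
  split : Legal N (xs ∷ʳ x) → InRange N x × CanPrecede xs x
  split (inRange , pairs) =
    let inRangeXs , inRangeX = All.++⁻ xs inRange
        pairsXs , toX = allPairs-∷ʳ⁻ xs pairs
    in All.head inRangeX , pairsXs , All.zipWith (λ ((p , _) , s) → p , s) (inRangeXs , toX)
  join : InRange N x × CanPrecede xs x → Legal N (xs ∷ʳ x)
  join (inRangeX@(_ , x≤N) , pairsXs , toX) =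
    All.++⁺ (All.map (λ (p , (y<x , _)) → p , ≤-trans (<⇒≤ y<x) x≤N) toX) (inRangeX ∷ []) ,
    AllPairs.++⁺ pairsXs ([] ∷ []) (All.map (λ (_ , s) → s ∷ []) toX)

separated⇔ : ∀ {y x} b → 1 ≤ y → bin x ≡ suc b → Separated y x ⇔ y ≤ double (b ∸ 1)
separated⇔ {y} {x} zero 1≤y binx = mk⇔ noRoom (λ y≤0 → ⊥-elim (≤⇒≯ y≤0 1≤y))
  where
  -- no index can lie two bins below bin 1
  noRoom : Separated y x → y ≤ 0
  noRoom (_ , gap) with ≤-trans (m≤n+m 2 (bin y)) (subst (_ ≤_) binx gap)
  ... | s≤s ()
separated⇔ {y} {x} (suc c) 1≤y binx = mk⇔ forward backward
  where
  gap⇔ : bin y + 2 ≤ bin x ⇔ bin y ≤ c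
  gap⇔ = mk⇔ (λ gap → ≤-pred (≤-pred (subst₂ _≤_ (+-comm (bin y) 2) binx gap)))
             (λ le → subst₂ _≤_ (+-comm 2 (bin y)) (sym binx) (s≤s (s≤s le)))
  forward : Separated y x → y ≤ double c
  forward (_ , gap) = bin≤⇒≤double c (to gap⇔ gap)
  backward : y ≤ double c → Separated y x
  backward y≤2c = y<x , gap
    where
    gap : bin y + 2 ≤ bin x
    gap = from gap⇔ (≤double⇒bin≤ c y≤2c)
    y<x : y < x
    y<x = ≰⇒> (λ x≤y → <⇒≱ (<-≤-trans (m<m+n (bin y) z<s) gap) (⌈n/2⌉-mono x≤y))

extend : List (List ℕ) → ℕ → List (List ℕ) → List (List ℕ)
extend X x Y = X ++ map (_∷ʳ x) Y

Enumerates : ℕ → List (List ℕ) → Set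
Enumerates M X = ∀ ℓs → ℓs ∈ X ⇔ Legal M ℓs

enumerates-[] : Enumerates 0 [ [] ]
enumerates-[] ℓs = mk⇔ (λ { (here refl) → [] , [] }) only-[]
  where
  only-[] : Legal 0 ℓs → ℓs ∈ [ [] ]
  only-[] ([] , []) = here refl
  only-[] (((1≤y , y≤0) ∷ _) , _) = ⊥-elim (≤⇒≯ y≤0 1≤y)

-- The legal lists with indices ≤ M+1 are those with indices ≤ M together
-- with the lists ending in M+1, whose other indices lie at least two bins
-- below bin(M+1) = b+1, i.e. are at most 2(b−1).
enumerates-extend : ∀ {M X Y} b → bin (suc M) ≡ suc b →
  Enumerates M X → Enumerates (double (b ∸ 1)) Y →
  Enumerates (suc M) (extend X (suc M) Y)
enumerates-extend {M} {X} {Y} b binM+1 enumX enumY ℓs = mk⇔ sound complete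
  where
  precedes⇔ : ∀ xs → CanPrecede xs (suc M) ⇔ Legal (double (b ∸ 1)) xs
  precedes⇔ xs = mk⇔
    (λ (pairs , toX) → All.map (λ (p , s) → p , to (separated⇔ b p binM+1) s) toX , pairs)
    (λ (inRange , pairs) → pairs , All.map (λ (p , le) → p , from (separated⇔ b p binM+1) le) inRange)
  sound : ℓs ∈ extend X (suc M) Y → Legal (suc M) ℓs
  sound mem with ∈-++⁻ X mem
  ... | inj₁ inX = legal-weaken (n≤1+n M) (to (enumX ℓs) inX)
  ... | inj₂ inMap with ∈-map⁻ (_∷ʳ suc M) inMap
  ... | xs , inY , refl =
    from (legal-∷ʳ xs (suc M)) ((s≤s z≤n , ≤-refl) , from (precedes⇔ xs) (to (enumY xs) inY))
  complete : Legal (suc M) ℓs → ℓs ∈ extend X (suc M) Y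
  complete legal with initLast ℓs
  ... | [] = ∈-++⁺ˡ (from (enumX []) ([] , []))
  ... | xs ∷ʳ′ x with to (legal-∷ʳ xs x) legal
  ... | (1≤x , x≤M+1) , precede with m≤n⇒m<n∨m≡n x≤M+1
  ... | inj₁ x≤M =
    ∈-++⁺ˡ (from (enumX _) (from (legal-∷ʳ xs x) ((1≤x , ≤-pred x≤M) , precede)))
  ... | inj₂ refl =
    ∈-++⁺ʳ X (∈-map⁺ (_∷ʳ suc M) (from (enumY xs) (to (precedes⇔ xs) precede)))

mutual
  enumE : ℕ → List (List ℕ)
  enumE zero = [ [] ]
  enumE (suc b) = extend (enumO b) (suc (suc (double b))) (enumP b)

  enumO : ℕ → List (List ℕ)
  enumO b = extend (enumE b) (suc (double b)) (enumP b)

  enumP : ℕ → List (List ℕ)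
  enumP zero = [ [] ]
  enumP (suc b) = enumE b

mutual
  enumE-enumerates : ∀ b → Enumerates (double b) (enumE b)
  enumE-enumerates zero = enumerates-[]
  enumE-enumerates (suc b) =
    enumerates-extend b (bin-even b) (enumO-enumerates b) (enumP-enumerates b)

  enumO-enumerates : ∀ b → Enumerates (suc (double b)) (enumO b)
  enumO-enumerates b =
    enumerates-extend b (bin-odd b) (enumE-enumerates b) (enumP-enumerates b)

  enumP-enumerates : ∀ b → Enumerates (double (b ∸ 1)) (enumP b)
  enumP-enumerates zero = enumerates-[]
  enumP-enumerates (suc b) = enumE-enumerates b

data Half : ℕ → Set where
  even : ∀ b → Half (double b)
  odd  : ∀ b → Half (suc (double b))

half : ∀ N → Half N
half zero = even zero
half (suc N) with half N
... | even b = odd b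
... | odd b = even (suc b)

half-double : ∀ b → half (double b) ≡ even b
half-double zero = refl
half-double (suc b) rewrite half-double b = refl

half-1+double : ∀ b → half (suc (double b)) ≡ odd b
half-1+double b rewrite half-double b = refl

enumOf : ∀ {N} → Half N → List (List ℕ)
enumOf (even b) = enumE b
enumOf (odd b) = enumO b

enum : ℕ → List (List ℕ)
enum N = enumOf (half N)

enum-enumerates : ∀ N → Enumerates N (enum N)
enum-enumerates N = enumOf-enumerates (half N)
  where
  enumOf-enumerates : ∀ {N} (h : Half N) → Enumerates N (enumOf h)
  enumOf-enumerates (even b) = enumE-enumerates b
  enumOf-enumerates (odd b) = enumO-enumerates b

A : ℕ → ℕ
A zero = zero
A (suc N) = length (enum N)

A-odd : ∀ b → A (suc (double b)) ≡ length (enumE b)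
A-odd b = cong (length ∘ enumOf) (half-double b)

A-even : ∀ b → A (suc (suc (double b))) ≡ length (enumO b)
A-even b = cong (length ∘ enumOf) (half-1+double b)

value : List ℕ → ℕ
value ℓs = sum (map A ℓs)

value-∷ʳ : ∀ ℓs x → value (ℓs ∷ʳ x) ≡ A x + value ℓs
value-∷ʳ ℓs x = begin
  sum (map A (ℓs ++ [ x ]))      ≡⟨ cong sum (map-++ A ℓs [ x ]) ⟩
  sum (map A ℓs ++ [ A x ])      ≡⟨ sum-++ (map A ℓs) [ A x ] ⟩
  value ℓs + (A x + 0)           ≡⟨ cong (value ℓs +_) (+-identityʳ (A x)) ⟩
  value ℓs + A x                 ≡⟨ +-comm (value ℓs) (A x) ⟩
  A x + value ℓs                 ∎
  where open ≡-Reasoning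

Consecutive : List (List ℕ) → Set
Consecutive X = map value X ≡ upTo (length X)

applyUpTo-+ : ∀ (f : ℕ → ℕ) m n →
  applyUpTo f (m + n) ≡ applyUpTo f m ++ applyUpTo (λ i → f (m + i)) n
applyUpTo-+ f zero n = refl
applyUpTo-+ f (suc m) n = cong (f 0 ∷_) (applyUpTo-+ (f ∘ suc) m n)

consecutive-extend : ∀ {X Y x} → Consecutive X → Consecutive Y → A x ≡ length X →
  Consecutive (extend X x Y)
consecutive-extend {X} {Y} {x} consX consY Ax≡|X| = begin
  map value (X ++ map (_∷ʳ x) Y)                   ≡⟨ map-++ value X _ ⟩
  map value X ++ map value (map (_∷ʳ x) Y)         ≡⟨ cong₂ _++_ consX shifted ⟩
  upTo (length X) ++ applyUpTo (length X +_) (length Y)  ≡⟨ applyUpTo-+ (λ i → i) (length X) (length Y) ⟨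
  upTo (length X + length Y)                       ≡⟨ cong upTo lengths ⟨
  upTo (length (extend X x Y))                     ∎
  where
  open ≡-Reasoning
  lengths : length (extend X x Y) ≡ length X + length Y
  lengths = trans (length-++ X) (cong (length X +_) (length-map (_∷ʳ x) Y))
  shifted : map value (map (_∷ʳ x) Y) ≡ applyUpTo (length X +_) (length Y)
  shifted = begin
    map value (map (_∷ʳ x) Y)         ≡⟨ map-∘ Y ⟨
    map (value ∘ (_∷ʳ x)) Y           ≡⟨ map-cong (λ ℓs → trans (value-∷ʳ ℓs x) (cong (_+ value ℓs) Ax≡|X|)) Y ⟩
    map ((length X +_) ∘ value) Y     ≡⟨ map-∘ Y ⟩
    map (length X +_) (map value Y)   ≡⟨ cong (map (length X +_)) consY ⟩
    map (length X +_) (upTo (length Y)) ≡⟨ map-upTo (length X +_) (length Y) ⟩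
    applyUpTo (length X +_) (length Y) ∎

mutual
  enumE-consecutive : ∀ b → Consecutive (enumE b)
  enumE-consecutive zero = refl
  enumE-consecutive (suc b) =
    consecutive-extend (enumO-consecutive b) (enumP-consecutive b) (A-even b)

  enumO-consecutive : ∀ b → Consecutive (enumO b)
  enumO-consecutive b =
    consecutive-extend (enumE-consecutive b) (enumP-consecutive b) (A-odd b)

  enumP-consecutive : ∀ b → Consecutive (enumP b)
  enumP-consecutive zero = refl
  enumP-consecutive (suc b) = enumE-consecutive b

enum-consecutive : ∀ N → Consecutive (enum N)
enum-consecutive N = enumOf-consecutive (half N)
  where
  enumOf-consecutive : ∀ {N} (h : Half N) → Consecutive (enumOf h)
  enumOf-consecutive (even b) = enumE-consecutive b
  enumOf-consecutive (odd b) = enumO-consecutive b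

value<A : ∀ {N ℓs} → Legal N ℓs → value ℓs < A (suc N)
value<A {N} {ℓs} legal =
  ∈-upTo⁻ (subst (value ℓs ∈_) (enum-consecutive N) (∈-map⁺ value (from (enum-enumerates N ℓs) legal)))

<A⇒legal : ∀ {N m} → m < A (suc N) → ∃[ ℓs ] (Legal N ℓs × value ℓs ≡ m)
<A⇒legal {N} {m} m<A with ∈-map⁻ value (subst (m ∈_) (sym (enum-consecutive N)) (∈-upTo⁺ m<A))
... | ℓs , inEnum , m≡ = ℓs , to (enum-enumerates N ℓs) inEnum , sym m≡

≤-from-< : ∀ {x y} → (∀ m → m < x → m < y) → x ≤ y
≤-from-< {zero} _ = z≤n
≤-from-< {suc x} below = below x ≤-refl

A-pos : ∀ N → 1 ≤ A (suc N)
A-pos N = value<A {N} ([] , [])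

-- Every value reachable with indices ≤ N is reachable with indices ≤ N+1.
A-step : ∀ N → A (suc N) ≤ A (suc (suc N))
A-step N = ≤-from-< λ m m<A →
  let ℓs , legal , value≡m = <A⇒legal m<A
  in subst (_< A (suc (suc N))) value≡m (value<A (legal-weaken (n≤1+n N) legal))

A-mono : ∀ {i j} → 1 ≤ i → i ≤ j → A i ≤ A j
A-mono {suc i} {suc j} _ (s≤s i≤j) = fromSuc (≤⇒≤′ i≤j)
  where
  fromSuc : ∀ {j} → i ≤′ j → A (suc i) ≤ A (suc j)
  fromSuc ≤′-refl = ≤-refl
  fromSuc (≤′-step {j} i≤′j) = ≤-trans (fromSuc i≤′j) (A-step j)

legal-below : ∀ {N M ℓs} → Legal N ℓs → value ℓs < A (suc M) → Legal M ℓs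
legal-below {N} {M} (inRange , pairs) small = shrink inRange small , pairs
  where
  shrink : ∀ {ℓs} → All (InRange N) ℓs → value ℓs < A (suc M) → All (InRange M) ℓs
  shrink [] _ = []
  shrink {y ∷ ℓs} ((1≤y , _) ∷ inRange) Ay+v<A = (1≤y , y≤M) ∷ shrink inRange (≤-<-trans (m≤n+m _ (A y)) Ay+v<A)
    where
    y≤M : y ≤ M
    y≤M = ≮⇒≥ λ M<y → <⇒≱ Ay+v<A (≤-trans (A-mono (s≤s z≤n) M<y) (m≤m+n (A y) (value ℓs)))

AgreeUpTo : (ℕ → ℕ) → ℕ → Set
AgreeUpTo a N = ∀ j → 1 ≤ j → j ≤ N → a j ≡ A j

sum-agree : ∀ {a N ℓs} → AgreeUpTo a N → All (InRange N) ℓs → sum (map a ℓs) ≡ value ℓs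
sum-agree agree [] = refl
sum-agree agree ((1≤y , y≤N) ∷ inRange) = cong₂ _+_ (agree _ 1≤y y≤N) (sum-agree agree inRange)

representable⇔ : ∀ {a N m} → AgreeUpTo a N → HasLegalDecomp a N m ⇔ m < A (suc N)
representable⇔ {N = N} agree = mk⇔
  (λ (ℓs , indices , sum≡m) →
    subst (_< A (suc N)) (trans (sym (sum-agree agree (proj₁ indices))) sum≡m)
          (value<A (indices⇒legal indices)))
  (λ m<A → let ℓs , legal , value≡m = <A⇒legal m<A
           in ℓs , legal⇒indices legal , trans (sum-agree agree (proj₁ legal)) value≡m)

least-excluded : ∀ {P : ℕ → Set} {x t} → (∀ m → P m ⇔ m < t) → 1 ≤ t →
  ¬ P x → (∀ m → 1 ≤ m → m < x → P m) → x ≡ t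
least-excluded spec 1≤t ¬Px below = ≤-antisym
  (≮⇒≥ λ t<x → <-irrefl refl (to (spec _) (below _ 1≤t t<x)))
  (≮⇒≥ λ x<t → ¬Px (from (spec _) x<t))

-- Each Kentucky-2 term is the least positive non-representable integer,
-- which is A(N+1) once the earlier terms agree with A.
kentucky-step : ∀ {a} → IsKentucky2 a → ∀ N → AgreeUpTo a N → a (suc N) ≡ A (suc N)
kentucky-step (a₁≡1 , _) zero _ = a₁≡1
kentucky-step (_ , next) (suc N) agree =
  let _ , unrepresentable , representable = next (suc N) (s≤s z≤n)
  in least-excluded (λ m → representable⇔ agree) (A-pos (suc N)) unrepresentable representable

kentucky≡A : ∀ {a} → IsKentucky2 a → ∀ N → AgreeUpTo a N
kentucky≡A K zero j 1≤j j≤0 = ⊥-elim (≤⇒≯ j≤0 1≤j)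
kentucky≡A K (suc N) j 1≤j j≤N+1 with m≤n⇒m<n∨m≡n j≤N+1
... | inj₁ j≤N = kentucky≡A K N j 1≤j (≤-pred j≤N)
... | inj₂ refl = kentucky-step K N (kentucky≡A K N)

ofLength : ℕ → List (List ℕ) → List (List ℕ)
ofLength k = filter (λ ℓs → length ℓs ≟ k)

count : ℕ → List (List ℕ) → ℕ
count k X = length (ofLength k X)

length-∷ʳ : ∀ (ℓs : List ℕ) x → length (ℓs ∷ʳ x) ≡ suc (length ℓs)
length-∷ʳ ℓs x = trans (length-++ ℓs) (+-comm (length ℓs) 1)

-- appending an index shifts lengths by one, so it never yields length 0
ofLength-∷ʳ : ∀ k x X → ofLength (suc k) (map (_∷ʳ x) X) ≡ map (_∷ʳ x) (ofLength k X)
ofLength-∷ʳ k x [] = refl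
ofLength-∷ʳ k x (ℓs ∷ X) with length ℓs ≟ k
... | yes len≡k = begin
  ofLength (suc k) ((ℓs ∷ʳ x) ∷ map (_∷ʳ x) X)
    ≡⟨ filter-accept (λ ℓs → length ℓs ≟ suc k) {x = ℓs ∷ʳ x} {xs = map (_∷ʳ x) X} (trans (length-∷ʳ ℓs x) (cong suc len≡k)) ⟩
  (ℓs ∷ʳ x) ∷ ofLength (suc k) (map (_∷ʳ x) X)
    ≡⟨ cong ((ℓs ∷ʳ x) ∷_) (ofLength-∷ʳ k x X) ⟩
  map (_∷ʳ x) (ℓs ∷ ofLength k X)
    ≡⟨ cong (map (_∷ʳ x)) (filter-accept (λ ℓs → length ℓs ≟ k) {x = ℓs} {xs = X} len≡k) ⟨
  map (_∷ʳ x) (ofLength k (ℓs ∷ X)) ∎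
  where open ≡-Reasoning
... | no len≢k = begin
  ofLength (suc k) ((ℓs ∷ʳ x) ∷ map (_∷ʳ x) X)
    ≡⟨ filter-reject (λ ℓs → length ℓs ≟ suc k) {x = ℓs ∷ʳ x} {xs = map (_∷ʳ x) X} (len≢k ∘ suc-injective ∘ trans (sym (length-∷ʳ ℓs x))) ⟩
  ofLength (suc k) (map (_∷ʳ x) X)
    ≡⟨ ofLength-∷ʳ k x X ⟩
  map (_∷ʳ x) (ofLength k X)
    ≡⟨ cong (map (_∷ʳ x)) (filter-reject (λ ℓs → length ℓs ≟ k) {x = ℓs} {xs = X} len≢k) ⟨
  map (_∷ʳ x) (ofLength k (ℓs ∷ X)) ∎
  where open ≡-Reasoning

ofLength-0-∷ʳ : ∀ x X → ofLength 0 (map (_∷ʳ x) X) ≡ []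
ofLength-0-∷ʳ x X = filter-none (λ ℓs → length ℓs ≟ 0)
  (All.map⁺ (All.universal (λ ℓs → 1+n≢0 ∘ trans (sym (length-∷ʳ ℓs x))) X))

count-++ : ∀ k X Y → count k (X ++ Y) ≡ count k X + count k Y
count-++ k X Y = trans (cong length (filter-++ (λ ℓs → length ℓs ≟ k) X Y)) (length-++ (ofLength k X))

-- Appending an index lengthens each appended list by one.
count-extend : ∀ k X x Y → count (suc k) (extend X x Y) ≡ count (suc k) X + count k Y
count-extend k X x Y = begin
  count (suc k) (extend X x Y)                          ≡⟨ count-++ (suc k) X _ ⟩
  count (suc k) X + count (suc k) (map (_∷ʳ x) Y)       ≡⟨ cong (λ Z → count (suc k) X + length Z) (ofLength-∷ʳ k x Y) ⟩
  count (suc k) X + length (map (_∷ʳ x) (ofLength k Y)) ≡⟨ cong (count (suc k) X +_) (length-map (_∷ʳ x) (ofLength k Y)) ⟩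
  count (suc k) X + count k Y                           ∎
  where open ≡-Reasoning

count-0-extend : ∀ X x Y → count 0 (extend X x Y) ≡ count 0 X
count-0-extend X x Y = begin
  count 0 (extend X x Y)                    ≡⟨ count-++ 0 X _ ⟩
  count 0 X + length (ofLength 0 (map (_∷ʳ x) Y)) ≡⟨ cong (λ Z → count 0 X + length Z) (ofLength-0-∷ʳ x Y) ⟩
  count 0 X + 0                             ≡⟨ +-identityʳ (count 0 X) ⟩
  count 0 X                                 ∎
  where open ≡-Reasoning

-- Pascal's rule in the shifted form used below; both sides vanish when k > b.
pascal : ∀ b k → (suc b ∸ k) C suc k ≡ (b ∸ k) C suc k + (b ∸ k) C k
pascal b k with k ≤? b
... | yes k≤b = begin
  (suc b ∸ k) C suc k                 ≡⟨ cong (_C suc k) (+-∸-assoc 1 k≤b) ⟩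
  suc (b ∸ k) C suc k                 ≡⟨ nCk+nC[k+1]≡[n+1]C[k+1] (b ∸ k) k ⟨
  (b ∸ k) C k + (b ∸ k) C suc k       ≡⟨ +-comm ((b ∸ k) C k) _ ⟩
  (b ∸ k) C suc k + (b ∸ k) C k       ∎
  where open ≡-Reasoning
... | no k≰b with ≰⇒> k≰b
... | s≤s b≤k-1 rewrite m≤n⇒m∸n≡0 b≤k-1 | m≤n⇒m∸n≡0 (m≤n⇒m≤1+n b≤k-1) = refl

doubling : ∀ p X Y → (2 * p) * (X + Y) ≡ (2 * p) * X + p * Y + p * Y
doubling = solve-∀

-- Lists with indices ≤ 2(b+1): those with indices ≤ 2b+1 (in particular those
-- with indices ≤ 2b), plus two copies of P b extended by 2b+1 resp. 2b+2.
-- Hence #ₖ₊₁ P(b+2) = #ₖ₊₁ P(b+1) + 2 · #ₖ P b, solved by Pascal's rule.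
count-enumP : ∀ b k → count k (enumP b) ≡ 2 ^ k * ((b ∸ k) C k)
count-enumP zero zero = refl
count-enumP zero (suc k) = sym (*-zeroʳ (2 ^ suc k))
count-enumP (suc zero) zero = refl
count-enumP (suc zero) (suc k) rewrite 0∸n≡0 k = sym (*-zeroʳ (2 ^ suc k))
count-enumP (suc (suc b)) zero =
  trans (count-0-extend (enumO b) _ _) (trans (count-0-extend (enumE b) _ _) (count-enumP (suc b) zero))
count-enumP (suc (suc b)) (suc k) = begin
  count (suc k) (enumP (suc (suc b)))
    ≡⟨ count-extend k (enumO b) _ (enumP b) ⟩
  count (suc k) (enumO b) + count k (enumP b)
    ≡⟨ cong (_+ count k (enumP b)) (count-extend k (enumE b) _ (enumP b)) ⟩
  count (suc k) (enumP (suc b)) + count k (enumP b) + count k (enumP b)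
    ≡⟨ cong₂ (λ p q → p + q + q) (count-enumP (suc b) (suc k)) (count-enumP b k) ⟩
  2 ^ suc k * ((b ∸ k) C suc k) + 2 ^ k * ((b ∸ k) C k) + 2 ^ k * ((b ∸ k) C k)
    ≡⟨ doubling (2 ^ k) _ _ ⟨
  2 ^ suc k * ((b ∸ k) C suc k + (b ∸ k) C k)
    ≡⟨ cong (2 ^ suc k *_) (pascal b k) ⟨
  2 ^ suc k * ((suc b ∸ k) C suc k) ∎
  where open ≡-Reasoning

withSummands : ℕ → ℕ → List ℕ
withSummands k M = map value (ofLength k (enum M))

-- Distinct lists of enum M have distinct values, since these values are 0, …, A(M+1)−1.
withSummands-unique : ∀ k M → Unique (withSummands k M)
withSummands-unique k M = AllPairs.map⁺ (AllPairs.filter⁺ (λ ℓs → length ℓs ≟ k)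
  (AllPairs.map⁻ (subst Unique (sym (enum-consecutive M)) (upTo⁺ (A (suc M))))))

withSummands⇔ : ∀ {a} → (∀ N → AgreeUpTo a N) → ∀ k M m →
  m ∈ withSummands k M ⇔ (m < A (suc M) × DecompHasSummands a m k)
withSummands⇔ {a} agree k M m = mk⇔ sound complete
  where
  sound : m ∈ withSummands k M → m < A (suc M) × DecompHasSummands a m k
  sound mem with ∈-map⁻ value mem
  ... | ℓs , inOfLength , m≡value with ∈-filter⁻ (λ ℓs → length ℓs ≟ k) inOfLength
  ... | inEnum , length≡k =
    let legal = to (enum-enumerates M ℓs) inEnum
    in subst (_< A (suc M)) (sym m≡value) (value<A legal) ,
       M , ℓs , (legal⇒indices legal , trans (sum-agree (agree M) (proj₁ legal)) (sym m≡value)) , length≡k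
  complete : m < A (suc M) × DecompHasSummands a m k → m ∈ withSummands k M
  complete (m<A , N , ℓs , (indices , sum≡m) , length≡k) =
    subst (_∈ withSummands k M) value≡m
      (∈-map⁺ value (∈-filter⁺ (λ ℓs → length ℓs ≟ k) (from (enum-enumerates M ℓs) legal) length≡k))
    where
    value≡m : value ℓs ≡ m
    value≡m = trans (sym (sum-agree (agree N) (proj₁ indices))) sum≡m
    legal : Legal M ℓs
    legal = legal-below (indices⇒legal indices) (subst (_< A (suc M)) (sym value≡m) m<A)

-- enum (2n) and P(n+1) both list the legal lists with indices ≤ 2n.
length-withSummands : ∀ k n → length (withSummands k (double n)) ≡ count k (enumP (suc n))
length-withSummands k n = trans (length-map value (ofLength k (enum (double n))))
  (cong (count k ∘ enumOf) (half-double n))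

proposition2p4 : (a : ℕ → ℕ) → IsKentucky2 a →
    (k n : ℕ) → 1 ≤ k → 1 + 2 * (k ∸ 1) ≤ n →
    ∃[ L ] (Unique L ×
            (∀ m → (m ∈ L) ⇔ (m < a (1 + 2 * n) × DecompHasSummands a m k)) ×
            length L ≡ 2 ^ k * ((n ∸ (k ∸ 1)) C k))
proposition2p4 a K zero n () _
proposition2p4 a K (suc k) n _ _ =
  withSummands (suc k) (double n) ,
  withSummands-unique (suc k) (double n) ,
  membership ,
  trans (length-withSummands (suc k) n) (count-enumP (suc n) (suc k))
  where
  agree : ∀ N → AgreeUpTo a N
  agree = kentucky≡A K
  a₂ₙ₊₁≡A : a (1 + 2 * n) ≡ A (suc (double n))
  a₂ₙ₊₁≡A = trans (cong (a ∘ suc) (2*n≡double n)) (agree (suc (double n)) _ (s≤s z≤n) ≤-refl)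
  membership : ∀ m → m ∈ withSummands (suc k) (double n) ⇔
                     (m < a (1 + 2 * n) × DecompHasSummands a m (suc k))
  membership m = subst (λ t → m ∈ withSummands (suc k) (double n) ⇔ (m < t × DecompHasSummands a m (suc k)))
    (sym a₂ₙ₊₁≡A) (withSummands⇔ agree (suc k) (double n) m)
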